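{- Let $l \geq 2$, $d \geq 0$ be integers, let $\mu>0$ be as in the context, and let $m_1, m_2 \in \mathbb{N}$. For all sufficiently large $n$ the following holds: if $\pi$ is a $\mu n$-rich partition of $V = [n]$ into parts $V_1, \ldots, V_l$ and $\mathcal{G} \in \mathbf{P}_{n,\pi}(l,d)$ has the $(m_1+m_2)$-extension property with respect to $\pi$, then whenever $p \in [l]$ and $X \subseteq V \setminus V_p$ with $|X| \leq m_1$, there are at least $m_2$ distinct vertices $v_1, \ldots, v_{m_2} \in V_p$ each of which is adjacent to every member of $X$.
   Context: Graphs are undirected and loopless; $\mathcal{G}[X]$ denotes the induced subgraph on $X$. A strong embedding of $\mathcal{A}$ into $\mathcal{B}$ is an injective vertex map $f$ such that $a,b$ are adjacent in $\mathcal{A}$ iff $f(a), f(b)$ are adjacent in $\mathcal{B}$. For a partition $\pi$ of $V=[n]$ into parts $V_1,\ldots,V_l$, $\mathbf{P}_{n,\pi}(l,d)$ is the set of graphs with vertex set $[n]$ in which every vertex of $V_i$ has at most $d$ neighbours in $V_i$, for each $i$. A partition into $l$ parts is $\alpha$-rich if each part has at least $\alpha$ elements. $k$-extension property: $\mathcal{G} \in \mathbf{P}_{n,\pi}(l,d)$ has it with respect to $\pi$ if for every $p \in [l]$ and every graph $\mathcal{H}$ whose vertex set is a union of mutually disjoint sets $X_1, X_2, Y$ with $|X_1|+|X_2|+|Y| \leq k$ and no edges between $X_1$ and $Y$: if $\mathcal{G}[V_p]$ has at least $n^{1/4}$ different induced subgraphs isomorphic to $\mathcal{H}[Y]$ and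 $h_0 : \mathcal{H}[X_1 \cup X_2] \to \mathcal{G}$ is a strong embedding with $h_0(X_1) \subseteq V_p$ and $h_0(X_2) \subseteq V \setminus V_p$, then $h_0$ extends to a strong embedding $h: \mathcal{H} \to \mathcal{G}$ with $h(Y) \subseteq V_p$. Standing assumption: $\mu>0$ is fixed such that there are $\lambda > 0$ and a constant $C$ with the property that for all sufficiently large $n$, the number of $l$-colourable graphs on $[n]$ admitting a proper $l$-colouring in which some colour class has fewer than $\mu n$ vertices is at most $2^{ -\lambda n^2 + Cn}$ times the number of all $l$-colourable graphs on $[n]$.
   Formalization: The constant $\mu$ of the standing assumption, and hence of the μn-richness condition, ranges over the positive rationals. -}

module Defs where

open import Data.Bool using (Bool; true; false; _∧_; _∨_; not; T)
open import Data.Nat as ℕ using (ℕ; zero; suc; _≤_; _^_)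
open import Data.Fin using (Fin; zero; suc)
open import Data.Fin.Properties using (_≟_)
open import Data.Fin.Subset using (Subset; _∈_; _⊆_; ∣_∣)
open import Data.List using (List; []; _∷_; [_]; map; concatMap; length; filterᵇ; allFin)
open import Data.Bool.ListAction using (all; any)
open import Data.List.Relation.Unary.All using (All)
open import Data.List.Relation.Unary.Unique.Propositional using (Unique)
open import Data.Vec.Functional using () renaming (_∷_ to _∷ᶠ_)
open import Data.Product using (Σ; ∃; ∃-syntax; _×_)
open import Data.Integer using (+_)
open import Data.Rational as ℚ using (ℚ; _/_)
open import Relation.Nullary using (¬_)
open import Relation.Nullary.Decidable using (⌊_⌋)
open import Relation.Binary.PropositionalEquality using (_≡_; _≢_)

record Graph (n : ℕ) : Set where
  field
    adj    : Fin n → Fin n → Bool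
    sym    : ∀ u v → adj u v ≡ adj v u
    irrefl : ∀ v → adj v v ≡ false
open Graph public

Adjacent : ∀ {n} → Graph n → Fin n → Fin n → Set
Adjacent G u v = adj G u v ≡ true

countFin : (n : ℕ) → (Fin n → Bool) → ℕ
countFin n P = length (filterᵇ P (allFin n))

ℕ→ℚ : ℕ → ℚ
ℕ→ℚ k = (+ k) / 1

Partition : ℕ → ℕ → Set
Partition n l = Fin n → Fin l

partSize : ∀ {n l} → Partition n l → Fin l → ℕ
partSize {n} π i = countFin n (λ v → ⌊ π v ≟ i ⌋)

MuRich : ∀ {n l} → ℚ → Partition n l → Set
MuRich {n} μ π = ∀ i → μ ℚ.* ℕ→ℚ n ℚ.≤ ℕ→ℚ (partSize π i)

InP : ∀ {n l} → Partition n l → ℕ → Graph n → Set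
InP {n} π d G = ∀ v → countFin n (λ u → ⌊ π u ≟ π v ⌋ ∧ adj G v u) ≤ d

StrongEmbOn : ∀ {k n} → Graph k → Graph n → (Fin k → Set) → (Fin k → Fin n) → Set
StrongEmbOn H G P f =
  ∀ u v → P u → P v → (f u ≡ f v → u ≡ v) × (adj H u v ≡ adj G (f u) (f v))

StrongEmb : ∀ {k n} → Graph k → Graph n → (Fin k → Fin n) → Set
StrongEmb H G f = ∀ u v → (f u ≡ f v → u ≡ v) × (adj H u v ≡ adj G (f u) (f v))

-- Extension property.
-- The test graph H has vertex set Fin k, split into the mutually disjoint
-- sets X1, X2, Y via a labelling.

data Part : Set where
  x₁ x₂ y : Part

IsoInduced : ∀ {k n} → Graph n → Subset n → Graph k → (Fin k → Part) → Set
IsoInduced {k} {n} G S H lab =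
  ∃[ f ] StrongEmbOn H G (λ v → lab v ≡ y) f
       × (∀ v → lab v ≡ y → f v ∈ S)
       × (∀ w → w ∈ S → ∃[ v ] (lab v ≡ y × f v ≡ w))

partSubset : ∀ {n l} → Partition n l → Fin l → Subset n
partSubset π p = Data.Vec.tabulate (λ v → ⌊ π v ≟ p ⌋)
  where import Data.Vec

-- G[V_p] has at least n^{1/4} different induced subgraphs isomorphic to H[Y]:
-- a list of N distinct vertex sets S ⊆ V_p with G[S] ≅ H[Y], where N^4 ≥ n.
ManyCopies : ∀ {n l k} → Partition n l → Fin l → Graph n → Graph k → (Fin k → Part) → Set
ManyCopies {n} π p G H lab =
  ∃[ Ss ] Unique Ss
        × All (λ S → S ⊆ partSubset π p × IsoInduced G S H lab) Ss
        × n ≤ length Ss ^ 4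

ExtensionProperty : ∀ {n l} → Partition n l → ℕ → Graph n → Set
ExtensionProperty {n} {l} π m G =
  ∀ (p : Fin l) (k : ℕ) (H : Graph k) (lab : Fin k → Part) →
  k ≤ m →
  (∀ u v → lab u ≡ x₁ → lab v ≡ y → adj H u v ≡ false) →
  ManyCopies π p G H lab →
  ∀ (h₀ : Fin k → Fin n) →
  StrongEmbOn H G (λ v → lab v ≢ y) h₀ →
  (∀ v → lab v ≡ x₁ → π (h₀ v) ≡ p) →
  (∀ v → lab v ≡ x₂ → π (h₀ v) ≢ p) →
  ∃[ h ] StrongEmb H G h
       × (∀ v → lab v ≢ y → h v ≡ h₀ v)
       × (∀ v → lab v ≡ y → π (h v) ≡ p)

allFuns : {A : Set} → List A → (k : ℕ) → List (Fin k → A)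
allFuns as zero    = [ (λ ()) ]
allFuns as (suc k) = concatMap (λ a → map (λ f → a ∷ᶠ f) (allFuns as k)) as

_==ᵇ_ : Bool → Bool → Bool
true  ==ᵇ b = b
false ==ᵇ b = not b

allMatrices : (n : ℕ) → List (Fin n → Fin n → Bool)
allMatrices n = allFuns (allFuns (true ∷ false ∷ []) n) n

isGraphᵇ : ∀ {n} → (Fin n → Fin n → Bool) → Bool
isGraphᵇ {n} a = all (λ u → not (a u u) ∧ all (λ v → a u v ==ᵇ a v u) (allFin n)) (allFin n)

properᵇ : ∀ {n l} → (Fin n → Fin n → Bool) → (Fin n → Fin l) → Bool
properᵇ {n} a c = all (λ u → all (λ v → not (a u v) ∨ not ⌊ c u ≟ c v ⌋) (allFin n)) (allFin n)

smallClassᵇ : ∀ {n l} → ℚ → (Fin n → Fin l) → Bool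
smallClassᵇ {n} {l} μ c =
  any (λ j → ⌊ ℕ→ℚ (countFin n (λ v → ⌊ c v ≟ j ⌋)) ℚ.<? μ ℚ.* ℕ→ℚ n ⌋) (allFin l)

numColourable : (l n : ℕ) → ℕ
numColourable l n = length (filterᵇ
  (λ a → isGraphᵇ a ∧ any (λ c → properᵇ a c) (allFuns (allFin l) n))
  (allMatrices n))

numBad : (l : ℕ) → ℚ → (n : ℕ) → ℕ
numBad l μ n = length (filterᵇ
  (λ a → isGraphᵇ a ∧ any (λ c → properᵇ a c ∧ smallClassᵇ μ c) (allFuns (allFin l) n))
  (allMatrices n))

-- Standing assumption: ∃ λ > 0, C, such that for all large n,
--   numBad ≤ 2^(-λ n² + C n) · numColourable.
-- Since the condition is monotone in λ (decreasing) and C (increasing), we may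
-- take λ = 1/(q+1) and C ∈ ℕ; raising to the (q+1)-th power the inequality reads
--   numBad^(q+1) · 2^(n²) ≤ 2^((q+1) C n) · numColourable^(q+1).
StandingAssumption : ℕ → ℚ → Set
StandingAssumption l μ =
  ∃[ q ] ∃[ C ] ∃[ N₀ ] ∀ n → N₀ ≤ n →
    numBad l μ n ^ suc q ℕ.* 2 ^ (n ℕ.* n)
      ≤ 2 ^ (suc q ℕ.* C ℕ.* n) ℕ.* numColourable l n ^ suc q

module Submission where

-- The vertices v₁, …, v_{m₂} are found one at a time. Given v₁, …, v_j, apply the extension
-- property to the graph H obtained from G[X ∪ {v₁, …, v_j}] by adding one new vertex, the
-- part Y, joined exactly to X (so X₂ = X and X₁ = {v₁, …, v_j}). The extension maps it to
-- some v_{j+1} ∈ V_p adjacent to all of X, and distinct from v₁, …, v_j because extensions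
-- are strong embeddings. That G[V_p] has n^{1/4} copies of the one-vertex graph H[Y] just
-- says |V_p|⁴ ≥ n, which follows from |V_p| ≥ μn once n ≥ 1/μ².

open import Defs hiding (sym)
open import Data.Nat using (ℕ; _≤_; _+_)
open import Data.Fin using (Fin)
open import Data.Fin.Subset using (Subset; _∈_; ∣_∣)
open import Data.Product using (Σ; ∃-syntax; _×_)
open import Data.Rational using (ℚ; 0ℚ; _<_)
open import Relation.Binary.PropositionalEquality using (_≡_; _≢_)

open import Data.Nat using (zero; suc; _*_; _^_; s≤s; z≤n)
import Data.Nat.Properties as ℕP
import Data.Nat.Coprimality as Coprimality
open import Data.Integer as ℤ using (+_; +[1+_]; -[1+_])
import Data.Integer.Properties as ℤP
open import Data.Rational as ℚ using (mkℚ)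
import Data.Rational.Properties as ℚP
import Data.Rational.Unnormalised as ℚᵘ
import Data.Rational.Unnormalised.Properties as ℚᵘP
open import Data.Bool using (Bool; true; false; not; T)
open import Data.Bool.Properties using (T-≡)
open import Data.Fin using () renaming (zero to fzero; suc to fsuc)
open import Data.Fin.Properties using (_≟_; suc-injective)
open import Data.Fin.Subset using (⁅_⁆; _⊆_)
open import Data.Fin.Subset.Properties using (x∈⁅x⁆; x∈⁅y⁆⇒x≡y)
open import Data.Vec using ([]; _∷_; here; there)
open import Data.Vec.Properties using (lookup⇒[]=; lookup∘tabulate)
open import Data.List as List using (List; lookup; length; filterᵇ; allFin; _++_)
import Data.List.Properties as ListP
open import Data.List.Relation.Unary.All as All using (All)
import Data.List.Relation.Unary.All.Properties as AllP
open import Data.List.Relation.Unary.All.Properties.Core using (¬Any⇒All¬)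
import Data.List.Relation.Unary.Any as Any
open import Data.List.Relation.Unary.Any.Properties using (lookup-index)
open import Data.List.Relation.Unary.AllPairs using (AllPairs)
open import Data.List.Relation.Unary.Unique.Propositional using (Unique)
import Data.List.Relation.Unary.Unique.Propositional.Properties as UniqueP
open import Data.List.Membership.Propositional using () renaming (_∈_ to _∈ˡ_; _∉_ to _∉ˡ_)
open import Data.List.Membership.Propositional.Properties using (∈-lookup; ∈-map⁺; ∈-map⁻; ∈-++⁺ˡ; ∈-++⁺ʳ)
open import Data.Product using (_,_; proj₁; proj₂)
open import Data.Empty using (⊥-elim)
open import Function using (_∘_; Equivalence)
open import Relation.Nullary using (yes; no)
open import Relation.Nullary.Decidable using (⌊_⌋)
open import Relation.Binary.PropositionalEquality using (refl; sym; trans; cong; subst; subst₂)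

mkℚ-ℕ : ℕ → ℚ
mkℚ-ℕ n = mkℚ (+ n) 0 (Coprimality.sym (Coprimality.1-coprimeTo n))

ℕ→ℚ≡mkℚ-ℕ : ∀ n → ℕ→ℚ n ≡ mkℚ-ℕ n
ℕ→ℚ≡mkℚ-ℕ n = ℚP.normalize-coprime (Coprimality.sym (Coprimality.1-coprimeTo n))

positive⇒scaling-bound : ∀ μ → 0ℚ < μ →
  ∃[ D ] ∀ n s → μ ℚ.* ℕ→ℚ n ℚ.≤ ℕ→ℚ s → n ≤ suc D * s
positive⇒scaling-bound (mkℚ (+ zero) _ _) 0<μ with () ← ℚ.positive 0<μ
positive⇒scaling-bound (mkℚ -[1+ _ ] _ _) 0<μ with () ← ℚ.positive 0<μ
positive⇒scaling-bound μ@(mkℚ +[1+ a ] d _) _ = d , bound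
  where
  bound : ∀ n s → μ ℚ.* ℕ→ℚ n ℚ.≤ ℕ→ℚ s → n ≤ suc d * s
  bound n s μn≤s rewrite ℕ→ℚ≡mkℚ-ℕ n | ℕ→ℚ≡mkℚ-ℕ s
    with ℚᵘ.*≤* cross ← ℚᵘP.≤-respˡ-≃ (ℚP.toℚᵘ-homo-* μ (mkℚ-ℕ n)) (ℚP.toℚᵘ-mono-≤ μn≤s) = begin
      n               ≤⟨ ℕP.m≤m+n n (a * n) ⟩
      suc a * n       ≤⟨ ℤP.drop‿+≤+ cross′ ⟩
      s * suc (d * 1) ≡⟨ cong (λ k → s * suc k) (ℕP.*-identityʳ d) ⟩
      s * suc d       ≡⟨ ℕP.*-comm s (suc d) ⟩
      suc d * s       ∎
    where
    open ℕP.≤-Reasoning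
    cross′ : + (suc a * n) ℤ.≤ + (s * suc (d * 1))
    cross′ = subst₂ ℤ._≤_ (trans (ℤP.*-identityʳ _) (ℤP.+◃n≡+n (suc a * n)))
                          (sym (ℤP.pos-* s (suc (d * 1)))) cross

square≤n≤scaled⇒n≤^4 : ∀ D n s → suc D * suc D ≤ n → n ≤ suc D * s → n ≤ s ^ 4
square≤n≤scaled⇒n≤^4 D n s D²≤n n≤Ds =
  bound (ℕP.*-cancelˡ-≤ (suc D) (ℕP.≤-trans D²≤n n≤Ds)) n≤Ds
  where
  bound : ∀ {s} → suc D ≤ s → n ≤ suc D * s → n ≤ s ^ 4
  bound {s@(suc _)} D<s n≤Ds = begin
    n         ≤⟨ n≤Ds ⟩
    suc D * s ≤⟨ ℕP.*-monoˡ-≤ s D<s ⟩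
    s * s     ≡⟨ cong (s *_) (sym (ℕP.*-identityʳ s)) ⟩
    s ^ 2     ≤⟨ ℕP.^-monoʳ-≤ s {2} {4} (s≤s (s≤s z≤n)) ⟩
    s ^ 4     ∎
    where open ℕP.≤-Reasoning

Unique⇒lookup-injective : ∀ {A : Set} {xs : List A} → Unique xs →
  ∀ i j → lookup xs i ≡ lookup xs j → i ≡ j
Unique⇒lookup-injective (_     AllPairs.∷ _)  fzero    fzero    _  = refl
Unique⇒lookup-injective (x∉xs  AllPairs.∷ _)  fzero    (fsuc j) eq = ⊥-elim (All.lookup x∉xs (∈-lookup j) eq)
Unique⇒lookup-injective (x∉xs  AllPairs.∷ _)  (fsuc i) fzero    eq = ⊥-elim (All.lookup x∉xs (∈-lookup i) (sym eq))
Unique⇒lookup-injective (_     AllPairs.∷ xs!) (fsuc i) (fsuc j) eq = cong fsuc (Unique⇒lookup-injective xs! i j eq)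

elements : ∀ {n} → Subset n → List (Fin n)
elements []          = List.[]
elements (true  ∷ S) = fzero List.∷ List.map fsuc (elements S)
elements (false ∷ S) = List.map fsuc (elements S)

length-elements : ∀ {n} (S : Subset n) → length (elements S) ≡ ∣ S ∣
length-elements []          = refl
length-elements (true  ∷ S) = cong suc (trans (ListP.length-map fsuc (elements S)) (length-elements S))
length-elements (false ∷ S) = trans (ListP.length-map fsuc (elements S)) (length-elements S)

length-elements-++ : ∀ {n} (S : Subset n) xs → length (elements S ++ xs) ≡ ∣ S ∣ + length xs
length-elements-++ S xs = trans (ListP.length-++ (elements S)) (cong (_+ length xs) (length-elements S))

elements-Unique : ∀ {n} (S : Subset n) → Unique (elements S)
elements-Unique []          = AllPairs.[]
elements-Unique (true  ∷ S) = ¬Any⇒All¬ _ 0∉ AllPairs.∷ UniqueP.map⁺ suc-injective (elements-Unique S)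
  where
  0∉ : fzero ∉ˡ List.map fsuc (elements S)
  0∉ 0∈ with _ , _ , () ← ∈-map⁻ fsuc 0∈
elements-Unique (false ∷ S) = UniqueP.map⁺ suc-injective (elements-Unique S)

∈-elements⁻ : ∀ {n} (S : Subset n) → All (_∈ S) (elements S)
∈-elements⁻ []          = All.[]
∈-elements⁻ (true  ∷ S) = here All.∷ AllP.map⁺ (All.map there (∈-elements⁻ S))
∈-elements⁻ (false ∷ S) = AllP.map⁺ (All.map there (∈-elements⁻ S))

∈-elements⁺ : ∀ {n} (S : Subset n) {x} → x ∈ S → x ∈ˡ elements S
∈-elements⁺ (true  ∷ S) here      = Any.here refl
∈-elements⁺ (true  ∷ S) (there x∈) = Any.there (∈-map⁺ fsuc (∈-elements⁺ S x∈))
∈-elements⁺ (false ∷ S) (there x∈) = ∈-map⁺ fsuc (∈-elements⁺ S x∈)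

module _ {n l : ℕ} (π : Partition n l) (G : Graph n) (p : Fin l) where

  partElements : List (Fin n)
  partElements = filterᵇ (λ v → ⌊ π v ≟ p ⌋) (allFin n)

  singletons-ManyCopies : ∀ {k} (H : Graph k) (lab : Fin k → Part) (u₀ : Fin k) →
    lab u₀ ≡ y → (∀ u → lab u ≡ y → u ≡ u₀) → n ≤ partSize π p ^ 4 → ManyCopies π p G H lab
  singletons-ManyCopies H lab u₀ u₀∈Y Y≡u₀ n≤|Vp|⁴ =
      List.map ⁅_⁆ partElements
    , UniqueP.map⁺ ⁅⁆-injective (UniqueP.filter⁺ _ (UniqueP.allFin⁺ n))
    , AllP.map⁺ (All.map singleton-copy (AllP.all-filter _ (allFin n)))
    , subst (λ t → n ≤ t ^ 4) (sym (ListP.length-map ⁅_⁆ partElements)) n≤|Vp|⁴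
    where
    ⁅⁆-injective : ∀ {a b : Fin n} → ⁅ a ⁆ ≡ ⁅ b ⁆ → a ≡ b
    ⁅⁆-injective {a} {b} eq = x∈⁅y⁆⇒x≡y b (subst (a ∈_) eq (x∈⁅x⁆ a))

    singleton-copy : ∀ {v} → T ⌊ π v ≟ p ⌋ → ⁅ v ⁆ ⊆ partSubset π p × IsoInduced G ⁅ v ⁆ H lab
    singleton-copy {v} v∈Vp =
        (λ {w} w∈ → subst (_∈ partSubset π p) (sym (x∈⁅y⁆⇒x≡y v w∈)) v∈part)
      , (λ _ → v) , embedding , (λ _ _ → x∈⁅x⁆ v) , (λ w w∈ → u₀ , u₀∈Y , sym (x∈⁅y⁆⇒x≡y v w∈))
      where
      v∈part : v ∈ partSubset π p
      v∈part = lookup⇒[]= v _ (trans (lookup∘tabulate _ v) (Equivalence.to T-≡ v∈Vp))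
      embedding : StrongEmbOn H G (λ u → lab u ≡ y) (λ _ → v)
      embedding u u′ u∈Y u′∈Y with refl ← Y≡u₀ u u∈Y | refl ← Y≡u₀ u′ u′∈Y =
        (λ _ → refl) , trans (irrefl H u₀) (sym (irrefl G v))

  outside : Fin n → Bool
  outside w = not ⌊ π w ≟ p ⌋

  side : Fin n → Part
  side w with π w ≟ p
  ... | yes _ = x₁
  ... | no  _ = x₂

  side≢y : ∀ w → side w ≢ y
  side≢y w with π w ≟ p
  ... | yes _ = λ ()
  ... | no  _ = λ ()

  side≡x₁⇒inside : ∀ w → side w ≡ x₁ → π w ≡ p × outside w ≡ false
  side≡x₁⇒inside w with π w ≟ p
  ... | yes π≡p = λ _ → π≡p , refl
  ... | no  _   = λ ()

  side≡x₂⇒π≢p : ∀ w → side w ≡ x₂ → π w ≢ p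
  side≡x₂⇒π≢p w with π w ≟ p
  ... | yes _   = λ ()
  ... | no  π≢p = λ _ → π≢p

  π≢p⇒outside : ∀ w → π w ≢ p → outside w ≡ true
  π≢p⇒outside w π≢p with π w ≟ p
  ... | yes π≡p = ⊥-elim (π≢p π≡p)
  ... | no  _   = refl

  module OneVertexExtension (Ls : List (Fin n)) where

    adjH : Fin (suc (length Ls)) → Fin (suc (length Ls)) → Bool
    adjH fzero    fzero    = false
    adjH fzero    (fsuc j) = outside (lookup Ls j)
    adjH (fsuc i) fzero    = outside (lookup Ls i)
    adjH (fsuc i) (fsuc j) = adj G (lookup Ls i) (lookup Ls j)

    H : Graph (suc (length Ls))
    H = record { adj = adjH ; sym = adjH-sym ; irrefl = adjH-irrefl }
      where
      adjH-sym : ∀ u v → adjH u v ≡ adjH v u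
      adjH-sym fzero    fzero    = refl
      adjH-sym fzero    (fsuc j) = refl
      adjH-sym (fsuc i) fzero    = refl
      adjH-sym (fsuc i) (fsuc j) = Graph.sym G (lookup Ls i) (lookup Ls j)
      adjH-irrefl : ∀ v → adjH v v ≡ false
      adjH-irrefl fzero    = refl
      adjH-irrefl (fsuc i) = irrefl G (lookup Ls i)

    lab : Fin (suc (length Ls)) → Part
    lab fzero    = y
    lab (fsuc i) = side (lookup Ls i)

    Y≡0 : ∀ u → lab u ≡ y → u ≡ fzero
    Y≡0 fzero    _   = refl
    Y≡0 (fsuc i) i∈Y = ⊥-elim (side≢y (lookup Ls i) i∈Y)

    X₁-Y-nonadjacent : ∀ u v → lab u ≡ x₁ → lab v ≡ y → adjH u v ≡ false
    X₁-Y-nonadjacent fzero    _        ()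
    X₁-Y-nonadjacent (fsuc i) fzero    i∈X₁ _   = proj₂ (side≡x₁⇒inside (lookup Ls i) i∈X₁)
    X₁-Y-nonadjacent (fsuc i) (fsuc j) _    j∈Y = ⊥-elim (side≢y (lookup Ls j) j∈Y)

    -- The value w at the Y-vertex is irrelevant: h₀ is only constrained off Y.
    h₀ : Fin n → Fin (suc (length Ls)) → Fin n
    h₀ w fzero    = w
    h₀ w (fsuc i) = lookup Ls i

    h₀-StrongEmbOn : Unique Ls → ∀ w → StrongEmbOn H G (λ v → lab v ≢ y) (h₀ w)
    h₀-StrongEmbOn _   w fzero    _        0∉Y _    = ⊥-elim (0∉Y refl)
    h₀-StrongEmbOn _   w (fsuc i) fzero    _   0∉Y = ⊥-elim (0∉Y refl)
    h₀-StrongEmbOn Ls! w (fsuc i) (fsuc j) _   _   =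
      (λ eq → cong fsuc (Unique⇒lookup-injective Ls! i j eq)) , refl

    h₀-X₁ : ∀ w v → lab v ≡ x₁ → π (h₀ w v) ≡ p
    h₀-X₁ w (fsuc i) i∈X₁ = proj₁ (side≡x₁⇒inside (lookup Ls i) i∈X₁)

    h₀-X₂ : ∀ w v → lab v ≡ x₂ → π (h₀ w v) ≢ p
    h₀-X₂ w (fsuc i) i∈X₂ = side≡x₂⇒π≢p (lookup Ls i) i∈X₂

    newVertex : ∀ {M} → ExtensionProperty π M G → n ≤ partSize π p ^ 4 → Fin n →
      Unique Ls → suc (length Ls) ≤ M →
      ∃[ v ] π v ≡ p × v ∉ˡ Ls × (∀ x → x ∈ˡ Ls → π x ≢ p → Adjacent G v x)
    newVertex ext n≤|Vp|⁴ w Ls! size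
      with h , h-strong , h≡h₀ , hY∈Vp ←
        ext p _ H lab size X₁-Y-nonadjacent (singletons-ManyCopies H lab fzero refl Y≡0 n≤|Vp|⁴)
            (h₀ w) (h₀-StrongEmbOn Ls! w) (h₀-X₁ w) (h₀-X₂ w)
      = h fzero , hY∈Vp fzero refl , h0∉Ls , h0-adjacent
      where
      h-lookup : ∀ i → h (fsuc i) ≡ lookup Ls i
      h-lookup i = h≡h₀ (fsuc i) (side≢y (lookup Ls i))

      h0∉Ls : h fzero ∉ˡ Ls
      h0∉Ls h0∈Ls with () ← proj₁ (h-strong fzero (fsuc (Any.index h0∈Ls)))
                             (trans (lookup-index h0∈Ls) (sym (h-lookup (Any.index h0∈Ls))))

      h0-adjacent : ∀ x → x ∈ˡ Ls → π x ≢ p → Adjacent G (h fzero) x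
      h0-adjacent x x∈Ls π≢p with i ← Any.index x∈Ls | refl ← lookup-index x∈Ls =
        subst (λ t → adj G (h fzero) t ≡ true) (h-lookup i)
              (trans (sym (proj₂ (h-strong fzero (fsuc i)))) (π≢p⇒outside (lookup Ls i) π≢p))

  elements++-Unique : ∀ X → (∀ x → x ∈ X → π x ≢ p) → ∀ {vs} → Unique vs →
    (∀ {v} → v ∈ˡ vs → π v ≡ p) → Unique (elements X ++ vs)
  elements++-Unique X X∩Vp≡∅ vs! vs⊆Vp = UniqueP.++⁺ (elements-Unique X) vs! λ (x∈X , x∈vs) →
    X∩Vp≡∅ _ (All.lookup (∈-elements⁻ X) x∈X) (vs⊆Vp x∈vs)

  commonNeighbourList : ∀ {M} → ExtensionProperty π M G → n ≤ partSize π p ^ 4 → Fin n →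
    (X : Subset n) → (∀ x → x ∈ X → π x ≢ p) → ∀ j → ∣ X ∣ + j ≤ M →
    ∃[ vs ] Unique vs × length vs ≡ j × All (λ v → π v ≡ p × ∀ x → x ∈ X → Adjacent G v x) vs
  commonNeighbourList ext n≤|Vp|⁴ w X X∩Vp≡∅ zero _ = List.[] , AllPairs.[] , refl , All.[]
  commonNeighbourList {M} ext n≤|Vp|⁴ w X X∩Vp≡∅ (suc j) size
    with vs , vs! , refl , vs-good ←
      commonNeighbourList ext n≤|Vp|⁴ w X X∩Vp≡∅ j (ℕP.≤-trans (ℕP.+-monoʳ-≤ ∣ X ∣ (ℕP.n≤1+n j)) size)
    with v , v∈Vp , v∉Ls , v-adjacent ←
      OneVertexExtension.newVertex (elements X ++ vs) ext n≤|Vp|⁴ w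
        (elements++-Unique X X∩Vp≡∅ vs! (proj₁ ∘ All.lookup vs-good))
        (subst (_≤ M) (trans (ℕP.+-suc ∣ X ∣ (length vs)) (cong suc (sym (length-elements-++ X vs)))) size)
    = v List.∷ vs , ¬Any⇒All¬ vs (v∉Ls ∘ ∈-++⁺ʳ (elements X)) AllPairs.∷ vs! , refl
    , (v∈Vp , λ x x∈X → v-adjacent x (∈-++⁺ˡ (∈-elements⁺ X x∈X)) (X∩Vp≡∅ x x∈X)) All.∷ vs-good

ExtensionProperty⇒commonNeighbours : ∀ {n l m₁ m₂} (π : Partition n l) (G : Graph n) →
  ExtensionProperty π (m₁ + m₂) G → ∀ p → n ≤ partSize π p ^ 4 → Fin n →
  ∀ X → (∀ x → x ∈ X → π x ≢ p) → ∣ X ∣ ≤ m₁ →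
  Σ (Fin m₂ → Fin n) λ vs → ((∀ i j → vs i ≡ vs j → i ≡ j)
          × (∀ i → π (vs i) ≡ p)
          × (∀ i x → x ∈ X → Adjacent G (vs i) x))
ExtensionProperty⇒commonNeighbours {m₂ = m₂} π G ext p n≤|Vp|⁴ w X X∩Vp≡∅ |X|≤m₁
  with vs , vs! , refl , vs-good ←
    commonNeighbourList π G p ext n≤|Vp|⁴ w X X∩Vp≡∅ m₂ (ℕP.+-monoˡ-≤ m₂ |X|≤m₁)
  = lookup vs , Unique⇒lookup-injective vs! , proj₁ ∘ good , proj₂ ∘ good
  where
  good : ∀ i → π (lookup vs i) ≡ p × ∀ x → x ∈ X → Adjacent G (lookup vs i) x
  good i = All.lookup vs-good (∈-lookup i)

lemma4p1 : ∀ (l d : ℕ) → 2 ≤ l → (μ : ℚ) → 0ℚ < μ → StandingAssumption l μ →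
  ∀ (m₁ m₂ : ℕ) → ∃[ N₀ ] ∀ (n : ℕ) → N₀ ≤ n →
    ∀ (π : Partition n l) → MuRich μ π →
    ∀ (G : Graph n) → InP π d G → ExtensionProperty π (m₁ + m₂) G →
    ∀ (p : Fin l) (X : Subset n) →
      (∀ x → x ∈ X → π x ≢ p) → ∣ X ∣ ≤ m₁ →
      Σ (Fin m₂ → Fin n) λ vs → ((∀ i j → vs i ≡ vs j → i ≡ j)
              × (∀ i → π (vs i) ≡ p)
              × (∀ i x → x ∈ X → Adjacent G (vs i) x))
lemma4p1 l d _ μ 0<μ _ m₁ m₂ =
  let D , scaled = positive⇒scaling-bound μ 0<μ in
  suc D * suc D , λ where
    (suc n) D²≤n π rich G _ ext p X X∩Vp≡∅ |X|≤m₁ →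
      ExtensionProperty⇒commonNeighbours π G ext p
        (square≤n≤scaled⇒n≤^4 D (suc n) (partSize π p) D²≤n (scaled (suc n) (partSize π p) (rich p)))
        fzero X X∩Vp≡∅ |X|≤m₁
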